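{- Let $n,b,a,k$ be positive integers with $b\le\frac n2$, $a\ge1$, $k\ge2$ and $b-k\ge a$. Then the graph $G_{b,a}$ contains a cycle of length $2k$.
   Context: For positive integers $n$, $b$, $a$, the graph $G_{b,a}=(V_b,E_a)$ has vertex set $V_b=\{x=(x_1,\dots,x_n): x_i\in\{0,1\},\ x_1+\dots+x_n=b\}$ and edge set $E_a=\{\{x,y\}: x,y\in V_b,\ (x,y)=a\}$, where $(x,y)$ is the standard inner product. -}

module Defs where

open import Data.Nat using (ℕ; zero; suc; _+_; _*_)
open import Data.Bool using (Bool; true; false; _∧_)
open import Data.Vec using (Vec; []; _∷_; count)
open import Data.Fin using (Fin; zero; suc; inject₁; fromℕ)
open import Data.Product using (_×_; Σ-syntax)
open import Function.Definitions using (Injective)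
open import Relation.Binary.PropositionalEquality using (_≡_)

-- 0/1 vectors of length n are represented as Vec Bool n (true = 1).

weight : ∀ {n} → Vec Bool n → ℕ
weight [] = 0
weight (true ∷ xs) = suc (weight xs)
weight (false ∷ xs) = weight xs

inner : ∀ {n} → Vec Bool n → Vec Bool n → ℕ
inner [] [] = 0
inner (x ∷ xs) (y ∷ ys) with x ∧ y
... | true = suc (inner xs ys)
... | false = inner xs ys

InV : ∀ {n} → ℕ → Vec Bool n → Set
InV b x = weight x ≡ b

Adj : ∀ {n} → ℕ → ℕ → Vec Bool n → Vec Bool n → Set
Adj b a x y = InV b x × InV b y × inner x y ≡ a

-- A cycle of length (suc m) in G_{b,a}: distinct vertices c 0, …, c m,
-- with c j ~ c (j+1) for j < m and c m ~ c 0.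
record CycleOfLength {n : ℕ} (b a : ℕ) (m : ℕ) : Set where
  field
    vert     : Fin (suc m) → Vec Bool n
    inV      : ∀ i → InV b (vert i)
    distinct : Injective _≡_ _≡_ vert
    step     : ∀ (j : Fin m) → Adj b a (vert (inject₁ j)) (vert (suc j))
    close    : Adj b a (vert (fromℕ m)) (vert zero)

-- The sets [t ∸ k, t) ∩ [0, k) for t = 0, …, 2k − 1 form a closed walk of length 2k in the
-- hypercube {0,1}ᵏ in which consecutive sets differ in exactly one element, and all 2k sets
-- are distinct (a set is recovered from its size and whether it contains k − 1).  Doubling
-- each coordinate x into the pair (¬(x ⊕ o), x ⊕ o), with the offset o alternating along the
-- walk, turns Hamming distance 1 into inner product 1 while giving every vertex weight k.
-- Prepending q + 1 zero coordinates (doubled the same way) and appending a − 1 common ones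
-- and enough zeros yields a 2k-cycle of G_{b,a} with b = a + k + q.
module Submission where

open import Defs
open import Data.Bool using (Bool; true; false; not; _∧_; _xor_; if_then_else_)
open import Data.Bool.Properties using (∧-identityʳ; not-involutive)
open import Data.Fin using (toℕ; fromℕ)
open import Data.Fin.Properties using (toℕ-injective; toℕ<n; toℕ-inject₁; toℕ-fromℕ)
open import Data.Nat using (ℕ; zero; suc; _+_; _*_; _∸_; _≤_; _<_; _<ᵇ_; z≤n; s≤s; z<s; s<s; s≤s⁻¹)
open import Data.Nat.Properties
open import Data.Nat.Tactic.RingSolver using (solve-∀)
open import Data.Product using (_,_)
open import Data.Vec using (Vec; []; _∷_; _++_; replicate; zipWith; lookup)
open import Data.Vec.Properties using (∷-injectiveˡ; ∷-injectiveʳ; ++-injectiveˡ; ++-injectiveʳ)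
open import Function using (_∘_)
open import Relation.Binary.PropositionalEquality
open import Relation.Nullary using (yes; no)

open ≡-Reasoning

private variable
  k m n s t u : ℕ

<⇒<ᵇ≡true : m < n → (m <ᵇ n) ≡ true
<⇒<ᵇ≡true {zero}  (s≤s _)   = refl
<⇒<ᵇ≡true {suc m} (s≤s m<n) = <⇒<ᵇ≡true m<n

≥⇒<ᵇ≡false : n ≤ m → (m <ᵇ n) ≡ false
≥⇒<ᵇ≡false z≤n       = refl
≥⇒<ᵇ≡false (s≤s n≤m) = ≥⇒<ᵇ≡false n≤m

xor-cancelʳ : ∀ o {x y} → x xor o ≡ y xor o → x ≡ y
xor-cancelʳ o     {true}  {true}  _  = refl
xor-cancelʳ o     {false} {false} _  = refl
xor-cancelʳ false {true}  {false} ()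
xor-cancelʳ true  {true}  {false} ()
xor-cancelʳ false {false} {true}  ()
xor-cancelʳ true  {false} {true}  ()

isOdd : ℕ → Bool
isOdd zero    = false
isOdd (suc n) = not (isOdd n)

isOdd-+-self : ∀ n → isOdd (n + n) ≡ false
isOdd-+-self zero    = refl
isOdd-+-self (suc n) = begin
  not (isOdd (n + suc n))    ≡⟨ cong (not ∘ isOdd) (+-suc n n) ⟩
  not (not (isOdd (n + n)))  ≡⟨ not-involutive _ ⟩
  isOdd (n + n)              ≡⟨ isOdd-+-self n ⟩
  false                      ∎

weight-++ : (x : Vec Bool m) (y : Vec Bool n) → weight (x ++ y) ≡ weight x + weight y
weight-++ []          y = refl
weight-++ (true  ∷ x) y = cong suc (weight-++ x y)
weight-++ (false ∷ x) y = weight-++ x y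

weight-replicate-true : ∀ m → weight (replicate m true) ≡ m
weight-replicate-true zero    = refl
weight-replicate-true (suc m) = cong suc (weight-replicate-true m)

weight-replicate-false : ∀ m → weight (replicate m false) ≡ 0
weight-replicate-false zero    = refl
weight-replicate-false (suc m) = weight-replicate-false m

inner-++ : (x x′ : Vec Bool m) (y y′ : Vec Bool n) →
           inner (x ++ y) (x′ ++ y′) ≡ inner x x′ + inner y y′
inner-++ []      []        y y′ = refl
inner-++ (b ∷ x) (b′ ∷ x′) y y′ with b ∧ b′
... | true  = cong suc (inner-++ x x′ y y′)
... | false = inner-++ x x′ y y′

inner-self : (x : Vec Bool n) → inner x x ≡ weight x
inner-self []          = refl
inner-self (true  ∷ x) = cong suc (inner-self x)
inner-self (false ∷ x) = inner-self x

dist : Vec Bool n → Vec Bool n → ℕ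
dist x y = weight (zipWith _xor_ x y)

dist-refl : (x : Vec Bool n) → dist x x ≡ 0
dist-refl []          = refl
dist-refl (true  ∷ x) = dist-refl x
dist-refl (false ∷ x) = dist-refl x

dist-++ˡ : (w : Vec Bool m) (x y : Vec Bool n) → dist (w ++ x) (w ++ y) ≡ dist x y
dist-++ˡ []          x y = refl
dist-++ˡ (true  ∷ w) x y = dist-++ˡ w x y
dist-++ˡ (false ∷ w) x y = dist-++ˡ w x y

encode : Bool → Vec Bool n → Vec Bool (n * 2)
encode o []      = []
encode o (x ∷ xs) = not (x xor o) ∷ (x xor o) ∷ encode o xs

weight-encode : ∀ o (x : Vec Bool n) → weight (encode o x) ≡ n
weight-encode o []       = refl
weight-encode o (x ∷ xs) with x xor o
... | true  = cong suc (weight-encode o xs)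
... | false = cong suc (weight-encode o xs)

-- Cells of equal bits are complementary, cells of different bits coincide.
inner-encode-not : ∀ o (x y : Vec Bool n) → inner (encode o x) (encode (not o) y) ≡ dist x y
inner-encode-not o     []            []            = refl
inner-encode-not false (false ∷ xs) (false ∷ ys) = inner-encode-not false xs ys
inner-encode-not false (false ∷ xs) (true  ∷ ys) = cong suc (inner-encode-not false xs ys)
inner-encode-not false (true  ∷ xs) (false ∷ ys) = cong suc (inner-encode-not false xs ys)
inner-encode-not false (true  ∷ xs) (true  ∷ ys) = inner-encode-not false xs ys
inner-encode-not true  (false ∷ xs) (false ∷ ys) = inner-encode-not true xs ys
inner-encode-not true  (false ∷ xs) (true  ∷ ys) = cong suc (inner-encode-not true xs ys)
inner-encode-not true  (true  ∷ xs) (false ∷ ys) = cong suc (inner-encode-not true xs ys)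
inner-encode-not true  (true  ∷ xs) (true  ∷ ys) = inner-encode-not true xs ys

encode-cancel : ∀ o (x y : Vec Bool n) → encode o x ≡ encode o y → x ≡ y
encode-cancel o []       []       _  = refl
encode-cancel o (x ∷ xs) (y ∷ ys) eq =
  cong₂ _∷_ (xor-cancelʳ o (∷-injectiveˡ (∷-injectiveʳ eq)))
            (encode-cancel o xs ys (∷-injectiveʳ (∷-injectiveʳ eq)))

-- A leading zero coordinate exposes the offset, so the offsets agree as well.
encode-injective : ∀ {o o′} (x y : Vec Bool n) → encode o (false ∷ x) ≡ encode o′ (false ∷ y) → x ≡ y
encode-injective {o = o} x y eq with ∷-injectiveˡ (∷-injectiveʳ eq)
... | refl = encode-cancel o x y (∷-injectiveʳ (∷-injectiveʳ eq))

tabulateℕ : ∀ k → (ℕ → Bool) → Vec Bool k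
tabulateℕ zero    g = []
tabulateℕ (suc k) g = g 0 ∷ tabulateℕ k (g ∘ suc)

tabulateℕ-cong : ∀ k {g h : ℕ → Bool} → (∀ {i} → i < k → g i ≡ h i) → tabulateℕ k g ≡ tabulateℕ k h
tabulateℕ-cong zero    g≗h = refl
tabulateℕ-cong (suc k) g≗h = cong₂ _∷_ (g≗h z<s) (tabulateℕ-cong k (λ i<k → g≗h (s<s i<k)))

lookup-tabulateℕ-fromℕ : ∀ k (g : ℕ → Bool) → lookup (tabulateℕ (suc k) g) (fromℕ k) ≡ g k
lookup-tabulateℕ-fromℕ zero    g = refl
lookup-tabulateℕ-fromℕ (suc k) g = lookup-tabulateℕ-fromℕ k (g ∘ suc)

initialSegment : ∀ k → ℕ → Vec Bool k
initialSegment k t = tabulateℕ k (_<ᵇ t)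

finalSegment : ∀ k → ℕ → Vec Bool k
finalSegment k s = tabulateℕ k (λ i → not (i <ᵇ s))

weight-initialSegment : t ≤ k → weight (initialSegment k t) ≡ t
weight-initialSegment {k = zero}  z≤n       = refl
weight-initialSegment {k = suc k} z≤n       = weight-initialSegment {k = k} z≤n
weight-initialSegment             (s≤s t≤k) = cong suc (weight-initialSegment t≤k)

weight-finalSegment : s ≤ k → weight (finalSegment k s) ≡ k ∸ s
weight-finalSegment {k = zero}  z≤n       = refl
weight-finalSegment {k = suc k} z≤n       = cong suc (weight-finalSegment {k = k} z≤n)
weight-finalSegment             (s≤s s≤k) = weight-finalSegment s≤k

dist-initialSegment-suc : t < k → dist (initialSegment k t) (initialSegment k (suc t)) ≡ 1
dist-initialSegment-suc {zero}  {suc k} _         = cong suc (dist-refl (initialSegment k 0))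
dist-initialSegment-suc {suc t}         (s<s t<k) = dist-initialSegment-suc t<k

dist-finalSegment-suc : s < k → dist (finalSegment k s) (finalSegment k (suc s)) ≡ 1
dist-finalSegment-suc {zero}  {suc k} _         = cong suc (dist-refl (finalSegment k 0))
dist-finalSegment-suc {suc s}         (s<s s<k) = dist-finalSegment-suc s<k

finalSegment-self : ∀ k → finalSegment k k ≡ initialSegment k 0
finalSegment-self zero    = refl
finalSegment-self (suc k) = cong (false ∷_) (finalSegment-self k)

window : ℕ → ℕ → ℕ → Bool
window k t i = not (i <ᵇ t ∸ k) ∧ (i <ᵇ t)

state : ∀ k → ℕ → Vec Bool k
state k t = tabulateℕ k (window k t)

state-initial : t ≤ k → state k t ≡ initialSegment k t
state-initial {t} {k} t≤k =
  tabulateℕ-cong k (λ {i} _ → cong (λ z → not (i <ᵇ z) ∧ (i <ᵇ t)) (m≤n⇒m∸n≡0 t≤k))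

state-final : ∀ k s → state k (k + s) ≡ finalSegment k s
state-final k s = tabulateℕ-cong k λ {i} i<k → begin
  not (i <ᵇ k + s ∸ k) ∧ (i <ᵇ k + s)  ≡⟨ cong₂ (λ z b → not (i <ᵇ z) ∧ b) (m+n∸m≡n k s)
                                                (<⇒<ᵇ≡true (<-≤-trans i<k (m≤m+n k s))) ⟩
  not (i <ᵇ s) ∧ true                  ≡⟨ ∧-identityʳ _ ⟩
  not (i <ᵇ s)                         ∎

state-period : ∀ k → state k (k + k) ≡ state k 0
state-period k = begin
  state k (k + k)     ≡⟨ state-final k k ⟩
  finalSegment k k    ≡⟨ finalSegment-self k ⟩
  initialSegment k 0  ≡⟨ state-initial z≤n ⟨
  state k 0           ∎

data Half (k : ℕ) : ℕ → Set where
  lower : t < k → Half k t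
  upper : s < k → Half k (k + s)

half : ∀ t → t < k + k → Half k t
half {k} t t<2k with t <? k
... | yes t<k = lower t<k
... | no  t≮k with m≤n⇒∃[o]m+o≡n (≮⇒≥ t≮k)
...   | s , refl = upper (+-cancelˡ-< k s k t<2k)

state-step : t < k + k → dist (state k t) (state k (suc t)) ≡ 1
state-step {t} {k} t<2k with half {k} t t<2k
... | lower t<k = begin
  dist (state k t) (state k (suc t))                   ≡⟨ cong₂ dist (state-initial (<⇒≤ t<k)) (state-initial t<k) ⟩
  dist (initialSegment k t) (initialSegment k (suc t)) ≡⟨ dist-initialSegment-suc t<k ⟩
  1                                                    ∎
... | upper {s} s<k = begin
  dist (state k (k + s)) (state k (suc (k + s)))     ≡⟨ cong (λ z → dist (state k (k + s)) (state k z)) (+-suc k s) ⟨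
  dist (state k (k + s)) (state k (k + suc s))       ≡⟨ cong₂ dist (state-final k s) (state-final k (suc s)) ⟩
  dist (finalSegment k s) (finalSegment k (suc s))   ≡⟨ dist-finalSegment-suc s<k ⟩
  1                                                  ∎

decode : ∀ k → Vec Bool (suc k) → ℕ
decode k x = if lookup x (fromℕ k) then (suc k + suc k) ∸ weight x else weight x

decode-initialSegment : t < suc k → decode k (initialSegment (suc k) t) ≡ t
decode-initialSegment {t} {k} t<k = begin
  decode k x                    ≡⟨ cong (λ b → if b then (suc k + suc k) ∸ weight x else weight x) last≡false ⟩
  weight x                      ≡⟨ weight-initialSegment (<⇒≤ t<k) ⟩
  t                             ∎
  where
  x : Vec Bool (suc k)
  x = initialSegment (suc k) t
  last≡false : lookup x (fromℕ k) ≡ false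
  last≡false = trans (lookup-tabulateℕ-fromℕ k (_<ᵇ t)) (≥⇒<ᵇ≡false (s≤s⁻¹ t<k))

decode-finalSegment : s < suc k → decode k (finalSegment (suc k) s) ≡ suc k + s
decode-finalSegment {s} {k} s<k = begin
  decode k x                    ≡⟨ cong (λ b → if b then (K + K) ∸ weight x else weight x) last≡true ⟩
  (K + K) ∸ weight x            ≡⟨ cong ((K + K) ∸_) (weight-finalSegment (<⇒≤ s<k)) ⟩
  (K + K) ∸ (K ∸ s)             ≡⟨ +-∸-assoc K (m∸n≤m K s) ⟩
  K + (K ∸ (K ∸ s))             ≡⟨ cong (K +_) (m∸[m∸n]≡n (<⇒≤ s<k)) ⟩
  K + s                         ∎
  where
  K : ℕ
  K = suc k
  x : Vec Bool K
  x = finalSegment K s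
  last≡true : lookup x (fromℕ k) ≡ true
  last≡true = trans (lookup-tabulateℕ-fromℕ k (λ i → not (i <ᵇ s)))
                    (cong not (≥⇒<ᵇ≡false (s≤s⁻¹ s<k)))

decode-state : t < suc k + suc k → decode k (state (suc k) t) ≡ t
decode-state {t} {k} t<2k with half {suc k} t t<2k
... | lower t<k     = trans (cong (decode k) (state-initial (<⇒≤ t<k))) (decode-initialSegment t<k)
... | upper {s} s<k = trans (cong (decode k) (state-final (suc k) s)) (decode-finalSegment s<k)

state-injective : t < suc k + suc k → u < suc k + suc k → state (suc k) t ≡ state (suc k) u → t ≡ u
state-injective {t} {k} {u} t<2k u<2k eq = begin
  t                          ≡⟨ decode-state t<2k ⟨
  decode k (state (suc k) t) ≡⟨ cong (decode k) eq ⟩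
  decode k (state (suc k) u) ≡⟨ decode-state u<2k ⟩
  u                          ∎

closedWalk⇒cycle : ∀ {b a} m (V : ℕ → Vec Bool n) →
                   (∀ t → InV b (V t)) →
                   (∀ {t u} → t < suc m → u < suc m → V t ≡ V u → t ≡ u) →
                   (∀ {t} → t < suc m → inner (V t) (V (suc t)) ≡ a) →
                   V (suc m) ≡ V 0 →
                   CycleOfLength b a m
closedWalk⇒cycle {b = b} {a} m V inV injective adjacent closed = record
  { vert     = V ∘ toℕ
  ; inV      = inV ∘ toℕ
  ; distinct = λ {i} {j} eq → toℕ-injective (injective (toℕ<n i) (toℕ<n j) eq)
  ; step     = λ j → subst (λ t → Adj b a (V t) (V (suc (toℕ j)))) (sym (toℕ-inject₁ j))
                           (edge (m<n⇒m<1+n (toℕ<n j)))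
  ; close    = subst₂ (Adj b a) (cong V (sym (toℕ-fromℕ m))) closed (edge (n<1+n m))
  }
  where
  edge : t < suc m → Adj b a (V t) (V (suc t))
  edge {t} t<m = inV t , inV (suc t) , adjacent t<m

module WindowCycle (k p : ℕ) {r} (tail : Vec Bool r) where

  K : ℕ
  K = suc k

  padded : ℕ → Vec Bool (suc p + K)
  padded t = replicate (suc p) false ++ state K t

  vertex : ℕ → Vec Bool ((suc p + K) * 2 + r)
  vertex t = encode (isOdd t) (padded t) ++ tail

  weight-vertex : ∀ t → weight (vertex t) ≡ suc p + K + weight tail
  weight-vertex t = trans (weight-++ (encode (isOdd t) (padded t)) tail)
                          (cong (_+ weight tail) (weight-encode (isOdd t) (padded t)))

  inner-vertex-suc : t < K + K → inner (vertex t) (vertex (suc t)) ≡ suc (weight tail)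
  inner-vertex-suc {t} t<2K = begin
    inner (vertex t) (vertex (suc t))
      ≡⟨ inner-++ (encode (isOdd t) (padded t)) (encode (isOdd (suc t)) (padded (suc t))) tail tail ⟩
    inner (encode (isOdd t) (padded t)) (encode (not (isOdd t)) (padded (suc t))) + inner tail tail
      ≡⟨ cong₂ _+_ (inner-encode-not (isOdd t) (padded t) (padded (suc t))) (inner-self tail) ⟩
    dist (padded t) (padded (suc t)) + weight tail
      ≡⟨ cong (_+ weight tail) (dist-++ˡ (replicate (suc p) false) (state K t) (state K (suc t))) ⟩
    dist (state K t) (state K (suc t)) + weight tail
      ≡⟨ cong (_+ weight tail) (state-step {k = K} t<2K) ⟩
    suc (weight tail)
      ∎

  vertex-period : vertex (K + K) ≡ vertex 0
  vertex-period = cong₂ (λ o x → encode o (replicate (suc p) false ++ x) ++ tail)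
                        (isOdd-+-self K) (state-period K)

  vertex-injective : t < K + K → u < K + K → vertex t ≡ vertex u → t ≡ u
  vertex-injective {t} {u} t<2K u<2K eq =
    state-injective t<2K u<2K
      (++-injectiveʳ (replicate p false) (replicate p false)
        (encode-injective _ _ (++-injectiveˡ (encode (isOdd t) (padded t)) (encode (isOdd u) (padded u)) eq)))

  windowCycle : ∀ {b a} → suc p + K + weight tail ≡ b → suc (weight tail) ≡ a →
                CycleOfLength {(suc p + K) * 2 + r} b a (2 * K ∸ 1)
  windowCycle refl refl =
    closedWalk⇒cycle (2 * K ∸ 1) vertex weight-vertex
      (λ t<m u<m → vertex-injective (bound t<m) (bound u<m))
      (inner-vertex-suc ∘ bound)
      (trans (cong vertex cycleLength) vertex-period)
    where
    cycleLength : suc (2 * K ∸ 1) ≡ K + K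
    cycleLength = cong (K +_) (+-identityʳ K)
    bound : t < suc (2 * K ∸ 1) → t < K + K
    bound {t} = subst (t <_) cycleLength

theorem8 : (n b a k : ℕ) → 1 ≤ b → 2 * b ≤ n → 1 ≤ a → 2 ≤ k → a + k ≤ b →
           CycleOfLength {n} b a (2 * k ∸ 1)
theorem8 n b zero    k        _ _    () _  _
theorem8 n b a       zero     _ _    _  () _
theorem8 n b (suc a) (suc k) _ 2b≤n _  _  a+k≤b
  with m≤n⇒∃[o]m+o≡n a+k≤b | m≤n⇒∃[o]m+o≡n 2b≤n
... | q , refl | e , refl =
  subst (λ n → CycleOfLength {n} (suc a + suc k + q) (suc a) (2 * suc k ∸ 1)) (length-eq a k q e)
    (WindowCycle.windowCycle k q tail
      (trans (cong (suc q + suc k +_) weight-tail) (weight-eq a k q))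
      (cong suc weight-tail))
  where
  tail : Vec Bool (a + (a + e))
  tail = replicate a true ++ replicate (a + e) false
  weight-tail : weight tail ≡ a
  weight-tail = begin
    weight tail
      ≡⟨ weight-++ (replicate a true) (replicate (a + e) false) ⟩
    weight (replicate a true) + weight (replicate (a + e) false)
      ≡⟨ cong₂ _+_ (weight-replicate-true a) (weight-replicate-false (a + e)) ⟩
    a + 0
      ≡⟨ +-identityʳ a ⟩
    a ∎
  weight-eq : ∀ a k q → suc q + suc k + a ≡ suc a + suc k + q
  weight-eq = solve-∀
  length-eq : ∀ a k q e → (suc q + suc k) * 2 + (a + (a + e)) ≡ 2 * (suc a + suc k + q) + e
  length-eq = solve-∀
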